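{- Let $H,G$ be two-terminal graphs with $G$ connected, and let $H(G)$ be the two-terminal graph obtained from $H$ by replacing every edge $uv$ of $H$ by a copy of $G$ (deleting the edge and identifying the source and sink of the copy with $u$ and $v$ in some order; the terminals of $H(G)$ are those of $H$). Then $\hat y_{H(G)}(p)$ does not depend on the chosen orientations and $$\hat y_{H(G)}(p)=\hat y_H\!\left(\frac{1}{\hat y_G(p)}\right).$$
   Context: Graphs are finite and may have parallel edges. For $G=(V,E)$, $R(G;p)=\sum_{A\subseteq E,\ (V,A)\text{ connected}}(1-p)^{|A|}p^{|E|-|A|}$. A two-terminal graph is $(G,s,t)$ with $s\neq t$. An $s$-$t$ split is a spanning subgraph in which every vertex has a path to exactly one of $s,t$; $S(G;p)=\sum_{A\subseteq E,\ (V,A)\ s\text{ - }t\text{ split}}(1-p)^{|A|}p^{|E|-|A|}$. The virtual edge interaction is the rational function $\hat y_G(p)=R(G;p)/S(G;p)+1$. -}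

module Defs where

open import Data.Bool using (Bool; true; false; _∧_; _∨_; _xor_; if_then_else_)
open import Data.Nat as ℕ using (ℕ; zero; suc)
open import Data.Fin as Fin using (Fin; punchOut; combine; _↑ˡ_; _↑ʳ_)
open import Data.Fin.Properties using (punchOut-injective; ↑ˡ-injective)
open import Data.Product using (_×_; _,_; proj₁; proj₂)
open import Data.List using (List; []; _∷_; map; foldr; allFin; _++_)
open import Data.Bool.ListAction using (all; any)
open import Data.Vec using (Vec; []; _∷_; lookup; replicate)
open import Data.Rational using (ℚ; 0ℚ; 1ℚ; _+_; _*_; _-_; _÷_; NonZero)
open import Relation.Nullary.Decidable using (⌊_⌋; yes; no)
open import Relation.Binary.PropositionalEquality using (_≡_; _≢_; refl; sym)
open import Function using (_∘_)

-- Multigraphs: vertices Fin n, edges Fin m, edge e has (unordered)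
-- endpoints edge e.  Parallel edges (and loops) are allowed.

record Graph (n m : ℕ) : Set where
  field
    edge : Fin m → Fin n × Fin n
open Graph public

record TwoTerminal (n m : ℕ) : Set where
  field
    graph : Graph n m
    src   : Fin n
    snk   : Fin n
    src≢snk : src ≢ snk
open TwoTerminal public

-- Spanning subgraphs: an edge subset A ⊆ E is a Vec Bool m.

subsets : (m : ℕ) → List (Vec Bool m)
subsets zero    = [] ∷ []
subsets (suc m) = map (true ∷_) (subsets m) ++ map (false ∷_) (subsets m)

_==_ : ∀ {n} → Fin n → Fin n → Bool
u == v = ⌊ u Fin.≟ v ⌋

walk : ∀ {n m} → ℕ → Graph n m → Vec Bool m → Fin n → Fin n → Bool
walk zero    G A u v = u == v
walk (suc k) G A u v =
  (u == v) ∨ any step (allFin _)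
  where
  step : Fin _ → Bool
  step e with edge G e
  ... | (a , b) = lookup A e ∧ (((a == u) ∧ walk k G A b v) ∨ ((b == u) ∧ walk k G A a v))

-- path in (V, A) from u to v  (a path exists iff a walk of length ≤ n does)
path : ∀ {n m} → Graph n m → Vec Bool m → Fin n → Fin n → Bool
path {n} G A u v = walk n G A u v

connectedᵇ : ∀ {n m} → Graph n m → Vec Bool m → Bool
connectedᵇ G A = all (λ u → all (λ v → path G A u v) (allFin _)) (allFin _)

Connected : ∀ {n m} → Graph n m → Set
Connected {m = m} G = connectedᵇ G (replicate m true) ≡ true

splitᵇ : ∀ {n m} → Graph n m → Fin n → Fin n → Vec Bool m → Bool
splitᵇ G s t A = all (λ v → path G A v s xor path G A v t) (allFin _)

weight : ∀ {m} → ℚ → Vec Bool m → ℚ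
weight p []          = 1ℚ
weight p (true ∷ A)  = (1ℚ - p) * weight p A
weight p (false ∷ A) = p * weight p A

sumℚ : List ℚ → ℚ
sumℚ = foldr _+_ 0ℚ

R : ∀ {n m} → Graph n m → ℚ → ℚ
R {m = m} G p = sumℚ (map (λ A → if connectedᵇ G A then weight p A else 0ℚ) (subsets m))

S : ∀ {n m} → TwoTerminal n m → ℚ → ℚ
S {m = m} G p =
  sumℚ (map (λ A → if splitᵇ (graph G) (src G) (snk G) A then weight p A else 0ℚ) (subsets m))

ŷ : ∀ {n m} (G : TwoTerminal n m) (p : ℚ) → .{{_ : NonZero (S G p)}} → ℚ
ŷ G p = (R (graph G) p ÷ S G p) + 1ℚ

-- G has vertex set Fin (2 + k) (any two-terminal graph has ≥ 2 vertices).
-- Vertices of H(G): Fin (nH + mH * k): the vertices of H, followed, for each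
-- edge e of H, by a copy of the k non-terminal vertices of G.
-- Edges of H(G): Fin (mH * mG): edge (e, f) is the copy of edge f of G in
-- the copy of G replacing edge e of H.
-- An orientation o : Fin mH → Bool says, for edge e = uv of H, whether the
-- source of G is identified with u and the sink with v (true) or vice versa.

-- index of a non-terminal vertex of G among the k non-terminal vertices
internal : ∀ {k} (s t v : Fin (suc (suc k))) → s ≢ t → v ≢ s → v ≢ t → Fin k
internal s t v s≢t v≢s v≢t =
  punchOut {i = punchOut s≢t} {j = punchOut {i = s} {j = v} (v≢s ∘ sym)}
    (λ eq → v≢t (sym (punchOut-injective s≢t (v≢s ∘ sym) eq)))

substitute : ∀ {nH mH k mG} → TwoTerminal nH mH → TwoTerminal (suc (suc k)) mG →
             (Fin mH → Bool) → TwoTerminal (nH ℕ.+ mH ℕ.* k) (mH ℕ.* mG)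
substitute {nH} {mH} {k} {mG} H G o = record
  { graph   = record { edge = newEdge }
  ; src     = src H ↑ˡ (mH ℕ.* k)
  ; snk     = snk H ↑ˡ (mH ℕ.* k)
  ; src≢snk = λ eq → src≢snk H (↑ˡ-injective (mH ℕ.* k) _ _ eq)
  }
  where
  place : Fin mH → Fin (suc (suc k)) → Fin (nH ℕ.+ mH ℕ.* k)
  place e x with edge (graph H) e | x Fin.≟ src G | x Fin.≟ snk G
  ... | (u , v) | yes _  | _      = (if o e then u else v) ↑ˡ (mH ℕ.* k)
  ... | (u , v) | no _   | yes _  = (if o e then v else u) ↑ˡ (mH ℕ.* k)
  ... | (u , v) | no x≢s | no x≢t =
        nH ↑ʳ combine e (internal (src G) (snk G) x (src≢snk G) x≢s x≢t)

  newEdge : Fin (mH ℕ.* mG) → Fin (nH ℕ.+ mH ℕ.* k) × Fin (nH ℕ.+ mH ℕ.* k)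
  newEdge i with Fin.remQuot {mH} mG i
  ... | (e , f) = place e (proj₁ (edge (graph G) f)) , place e (proj₂ (edge (graph G) f))

module Submission where

-- Cut an edge set A of H(G) into its blocks, one edge set of G per edge e of H.  If some
-- vertex of a block reaches neither terminal of its copy, it is cut off from the vertices of
-- H, so (V, A) is neither connected nor an s-t split.  Otherwise every vertex of H(G) is
-- joined to a vertex of H, and (V, A) is connected (resp. an s-t split) exactly when the
-- set X of edges e whose block joins the two terminals is so in H.  Among the blocks in
-- which every vertex reaches a terminal, those joining the terminals are exactly the
-- connected spanning subgraphs of G and the others exactly its s-t splits; summing over the
-- blocks therefore turns the weight of each X into
-- R(G)^|X| S(G)^(|E_H|-|X|) = (R(G) + S(G))^|E_H| (1-q)^|X| q^(|E_H|-|X|) with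
-- q = S(G)/(R(G) + S(G)) = 1/ŷ_G.  Both R(H(G)) and S(H(G)) pick up the same factor
-- (R(G) + S(G))^|E_H|, which cancels in ŷ.

open import Defs
open import Data.Bool using (Bool; true; false; T; T?; not; _∧_; _∨_; _xor_; if_then_else_)
open import Data.Bool.ListAction using (all; any)
open import Data.Bool.Properties using (T-≡; T-∧; T-∨; ∧-assoc)
open import Data.Empty using (⊥; ⊥-elim)
open import Data.Fin as Fin using (Fin; zero; suc; combine; remQuot; punchIn; punchOut; _↑ˡ_; _↑ʳ_)
open import Data.Fin.Properties
  using (remQuot-combine; combine-remQuot; combine-injectiveˡ; combine-injectiveʳ; ↑ʳ-injective; splitAt-↑ˡ; splitAt-↑ʳ; join-splitAt; punchIn-punchOut; punchOut-punchIn; punchOut-cong; punchInᵢ≢i; punchIn-injective)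
open import Data.List as List using ([]; _∷_; map; allFin)
open import Data.List.Properties using (map-cong; map-++; map-∘)
import Data.List.Relation.Unary.All.Properties as All
open import Data.List.Relation.Unary.Any using (satisfied)
import Data.List.Relation.Unary.Any.Properties as Any
open import Data.Nat as ℕ using (ℕ; zero; suc; _≤_; _<_; z≤n; s≤s)
import Data.Nat.Properties as ℕ
open import Data.Product as Product using (∃; ∃₂; ∃-syntax; _×_; _,_; proj₁; proj₂)
open import Data.Rational using (ℚ; 0ℚ; 1ℚ; _+_; _*_; _-_; _÷_; 1/_; NonZero; +-*-rawSemiring)
open import Algebra.Definitions.RawSemiring +-*-rawSemiring using (_^_)
open import Data.Rational.Properties
  using (+-identityˡ; +-identityʳ; +-assoc; *-zeroˡ; *-zeroʳ; *-identityˡ; *-identityʳ; *-assoc; *-distribˡ-+; *-distribʳ-+; *-inverseˡ; *-inverseʳ)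
open import Data.Rational.Solver using (module +-*-Solver)
open import Data.Sum as Sum using (_⊎_; inj₁; inj₂)
open import Data.Vec as Vec using (Vec; []; _∷_; lookup; tabulate)
open import Data.Vec.Properties using (lookup-++ˡ; lookup-++ʳ; lookup∘tabulate; tabulate∘lookup; tabulate-cong)
open import Function using (_∘_; id; Equivalence)
open import Relation.Binary.Construct.Closure.ReflexiveTransitive using (Star; ε; _◅_; _◅◅_; gmap; kleisliStar; reverse)
open import Relation.Binary.PropositionalEquality
open import Relation.Nullary using (Dec; yes; no; ¬_)
open import Relation.Nullary.Decidable using (toWitness; fromWitness)

open Equivalence using (to; from)
open +-*-Solver using (solve; _:=_; _:+_; _:*_; _:-_; con)

T-ext : ∀ {a b} → (T a → T b) → (T b → T a) → a ≡ b
T-ext {false} {false} _ _ = refl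
T-ext {false} {true}  _ g = ⊥-elim (g _)
T-ext {true}  {false} f _ = ⊥-elim (f _)
T-ext {true}  {true}  _ _ = refl

T-not⁺ : ∀ {a} → ¬ T a → T (not a)
T-not⁺ {false} _  = _
T-not⁺ {true}  ¬a = ¬a _

T-not⁻ : ∀ {a} → T (not a) → ¬ T a
T-not⁻ {false} _ ()

T-xor⁺ : ∀ {a b} → T (a ∨ b) → ¬ (T a × T b) → T (a xor b)
T-xor⁺ {false} a∨b _  = a∨b
T-xor⁺ {true}  _   ¬ab = T-not⁺ (λ b → ¬ab (_ , b))

T-xor⁻ : ∀ {a b} → T (a xor b) → T (a ∨ b)
T-xor⁻ {false} h = h
T-xor⁻ {true}  _ = _

T-xor-not : ∀ {a b} → T a → T (a xor b) → T (not b)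
T-xor-not {true} _ h = h

T-∨-stable : ∀ {a b} → (¬ T a → ¬ T b → ⊥) → T (a ∨ b)
T-∨-stable {true}          _ = _
T-∨-stable {false} {true}  _ = _
T-∨-stable {false} {false} h = h id id

module _ {n} (p : Fin n → Bool) where

  all-allFin⁺ : (∀ i → T (p i)) → T (all p (allFin n))
  all-allFin⁺ = All.all⁻ p ∘ All.tabulate⁺

  all-allFin⁻ : T (all p (allFin n)) → ∀ i → T (p i)
  all-allFin⁻ = All.tabulate⁻ ∘ All.all⁺ p (allFin n)

  any-allFin⁺ : ∀ i → T (p i) → T (any p (allFin n))
  any-allFin⁺ i = Any.any⁺ p ∘ Any.tabulate⁺ i

  any-allFin⁻ : T (any p (allFin n)) → ∃ λ i → T (p i)
  any-allFin⁻ = satisfied ∘ Any.any⁻ p (allFin n)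

_⊆_ : ∀ {n} → (Fin n → Bool) → (Fin n → Bool) → Set
p ⊆ q = ∀ i → T (p i) → T (q i)

count : ∀ {n} → (Fin n → Bool) → ℕ
count {zero}  p = 0
count {suc n} p = (if p zero then 1 else 0) ℕ.+ count (p ∘ suc)

count≤n : ∀ {n} (p : Fin n → Bool) → count p ≤ n
count≤n {zero}  p = z≤n
count≤n {suc n} p with p zero
... | true  = s≤s (count≤n (p ∘ suc))
... | false = ℕ.m≤n⇒m≤1+n (count≤n (p ∘ suc))

count-pos : ∀ {n} (p : Fin n → Bool) i → T (p i) → 0 < count p
count-pos p zero    pi with p zero
... | true = s≤s z≤n
count-pos p (suc i) pi with p zero
... | true  = s≤s z≤n
... | false = count-pos (p ∘ suc) i pi

count-mono : ∀ {n} (p q : Fin n → Bool) → p ⊆ q → count p ≤ count q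
count-mono {zero}  p q p⊆q = z≤n
count-mono {suc n} p q p⊆q with p zero in p₀ | q zero in q₀
... | true  | true  = s≤s (count-mono (p ∘ suc) (q ∘ suc) (p⊆q ∘ suc))
... | true  | false = ⊥-elim (subst T q₀ (p⊆q zero (subst T (sym p₀) _)))
... | false | true  = ℕ.m≤n⇒m≤1+n (count-mono (p ∘ suc) (q ∘ suc) (p⊆q ∘ suc))
... | false | false = count-mono (p ∘ suc) (q ∘ suc) (p⊆q ∘ suc)

count-⊆-≥ : ∀ {n} (p q : Fin n → Bool) → p ⊆ q → count q ≤ count p → q ⊆ p
count-⊆-≥ {suc n} p q p⊆q q≤p i with p zero in p₀ | q zero in q₀
count-⊆-≥ p q p⊆q q≤p i       | true  | false = ⊥-elim (subst T q₀ (p⊆q zero (subst T (sym p₀) _)))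
count-⊆-≥ p q p⊆q q≤p i       | false | true  =
  ⊥-elim (ℕ.<-irrefl refl (ℕ.<-≤-trans (s≤s (count-mono (p ∘ suc) (q ∘ suc) (p⊆q ∘ suc))) q≤p))
count-⊆-≥ p q p⊆q q≤p zero    | true  | true  = λ _ → subst T (sym p₀) _
count-⊆-≥ p q p⊆q q≤p zero    | false | false = λ q0 → ⊥-elim (subst T q₀ q0)
count-⊆-≥ p q p⊆q q≤p (suc i) | true  | true  = count-⊆-≥ (p ∘ suc) (q ∘ suc) (p⊆q ∘ suc) (ℕ.s≤s⁻¹ q≤p) i
count-⊆-≥ p q p⊆q q≤p (suc i) | false | false = count-⊆-≥ (p ∘ suc) (q ∘ suc) (p⊆q ∘ suc) q≤p i

module Reachability {n m} (G : Graph n m) (A : Vec Bool m) where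

  Adjacent : Fin n → Fin n → Set
  Adjacent x y = ∃[ e ] T (lookup A e) × (edge G e ≡ (x , y) ⊎ edge G e ≡ (y , x))

  Reach : Fin n → Fin n → Set
  Reach = Star Adjacent

  Adjacent-sym : ∀ {x y} → Adjacent x y → Adjacent y x
  Adjacent-sym (e , a , inj₁ xy) = e , a , inj₂ xy
  Adjacent-sym (e , a , inj₂ yx) = e , a , inj₁ yx

  Reach-sym : ∀ {x y} → Reach x y → Reach y x
  Reach-sym = reverse Adjacent-sym

  -- The local `step` of `walk`, so that `walk (suc k) G A u v` unfolds to
  -- `(u == v) ∨ any (step k u v) (allFin m)`.
  step : ℕ → Fin n → Fin n → Fin m → Bool
  step k u v e = lookup A e ∧ ((proj₁ (edge G e) == u ∧ walk k G A (proj₂ (edge G e)) v)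
                             ∨ (proj₂ (edge G e) == u ∧ walk k G A (proj₁ (edge G e)) v))

  walk-refl : ∀ k v → T (walk k G A v v)
  walk-refl zero    v = fromWitness refl
  walk-refl (suc k) v = from (T-∨ {v == v}) (inj₁ (fromWitness refl))

  walk-∷ : ∀ k {u w v} → Adjacent u w → T (walk k G A w v) → T (walk (suc k) G A u v)
  walk-∷ k {u} {w} {v} (e , a , ends) h =
    from T-∨ (inj₂ (any-allFin⁺ (step k u v) e (from T-∧ (a , from T-∨ (via ends)))))
    where
    via : edge G e ≡ (u , w) ⊎ edge G e ≡ (w , u) →
          T (proj₁ (edge G e) == u ∧ walk k G A (proj₂ (edge G e)) v)
          ⊎ T (proj₂ (edge G e) == u ∧ walk k G A (proj₁ (edge G e)) v)
    via (inj₁ uw) rewrite uw = inj₁ (from T-∧ (fromWitness refl , h))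
    via (inj₂ wu) rewrite wu = inj₂ (from T-∧ (fromWitness refl , h))

  walk-uncons : ∀ k {u v} → T (walk (suc k) G A u v) → u ≡ v ⊎ ∃[ w ] Adjacent u w × T (walk k G A w v)
  walk-uncons k {u} {v} h with to (T-∨ {u == v}) h
  ... | inj₁ u≡v = inj₁ (toWitness u≡v)
  ... | inj₂ h′ with any-allFin⁻ (step k u v) h′
  ... | e , stepₑ with to (T-∧ {lookup A e}) stepₑ
  ... | a , ends with to (T-∨ {proj₁ (edge G e) == u ∧ walk k G A (proj₂ (edge G e)) v}) ends
  ... | inj₁ fwd with to (T-∧ {proj₁ (edge G e) == u}) fwd
  ...   | x≡u , hy = inj₂ (_ , (e , a , inj₁ (cong (_, _) (toWitness x≡u))) , hy)
  walk-uncons k {u} h | inj₂ _ | e , _ | a , _ | inj₂ bwd with to (T-∧ {proj₂ (edge G e) == u}) bwd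
  ...   | y≡u , hx = inj₂ (_ , (e , a , inj₂ (cong (_ ,_) (toWitness y≡u))) , hx)

  walk⇒Reach : ∀ k {u v} → T (walk k G A u v) → Reach u v
  walk⇒Reach zero    h with toWitness h
  ... | refl = ε
  walk⇒Reach (suc k) h with walk-uncons k h
  ... | inj₁ refl            = ε
  ... | inj₂ (w , a , h′)    = a ◅ walk⇒Reach k h′

  walk-mono : ∀ k {u v} → T (walk k G A u v) → T (walk (suc k) G A u v)
  walk-mono zero    h with toWitness h
  ... | refl = walk-refl 1 _
  walk-mono (suc k) h with walk-uncons k h
  ... | inj₁ refl         = walk-refl (suc (suc k)) _
  ... | inj₂ (w , a , h′) = walk-∷ (suc k) a (walk-mono k h′)

  walk-mono-≤ : ∀ {j k u v} → j ≤ k → T (walk j G A u v) → T (walk k G A u v)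
  walk-mono-≤ {j} {k} j≤k h with ℕ.m≤n⇒∃[o]m+o≡n j≤k
  ... | d , refl = go d
    where
    go : ∀ d → T (walk (j ℕ.+ d) G A _ _)
    go zero    rewrite ℕ.+-identityʳ j = h
    go (suc d) rewrite ℕ.+-suc j d = walk-mono (j ℕ.+ d) (go d)

  -- The sets `reaches k` increase with k, and once they stop increasing every vertex joined
  -- to v is in them; as subsets of Fin n they stop increasing by k = n.
  module _ (v : Fin n) where

    reaches : ℕ → Fin n → Bool
    reaches k u = walk k G A u v

    Reach⇒reaches-plateau : ∀ k → reaches (suc k) ⊆ reaches k → ∀ {u} → Reach u v → T (reaches k u)
    Reach⇒reaches-plateau k plateau ε       = walk-refl k v
    Reach⇒reaches-plateau k plateau (a ◅ r) = plateau _ (walk-∷ k a (Reach⇒reaches-plateau k plateau r))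

    grows-or-plateaus : ∀ k → k < count (reaches k) ⊎ ∃[ j ] j ≤ k × reaches (suc j) ⊆ reaches j
    grows-or-plateaus zero = inj₁ (count-pos (reaches 0) v (walk-refl 0 v))
    grows-or-plateaus (suc k) with grows-or-plateaus k
    ... | inj₂ (j , j≤k , plateau) = inj₂ (j , ℕ.m≤n⇒m≤1+n j≤k , plateau)
    ... | inj₁ k<∣k∣ with count (reaches (suc k)) ℕ.≤? count (reaches k)
    ...   | yes ∣k+1∣≤∣k∣ =
            inj₂ (k , ℕ.n≤1+n k , count-⊆-≥ (reaches k) (reaches (suc k)) (λ _ → walk-mono k) ∣k+1∣≤∣k∣)
    ...   | no  ∣k+1∣≰∣k∣ = inj₁ (ℕ.<-≤-trans (s≤s k<∣k∣) (ℕ.≰⇒> ∣k+1∣≰∣k∣))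

    plateau-by-n : ∃[ j ] j ≤ n × reaches (suc j) ⊆ reaches j
    plateau-by-n with grows-or-plateaus n
    ... | inj₁ n<∣n∣    = ⊥-elim (ℕ.<-irrefl refl (ℕ.<-≤-trans n<∣n∣ (count≤n (reaches n))))
    ... | inj₂ plateau = plateau

  Reach⇒path : ∀ {u v} → Reach u v → T (path G A u v)
  Reach⇒path {v = v} r with plateau-by-n v
  ... | j , j≤n , plateau = walk-mono-≤ j≤n (Reach⇒reaches-plateau v j plateau r)

  path⇒Reach : ∀ {u v} → T (path G A u v) → Reach u v
  path⇒Reach = walk⇒Reach n

guard : Bool → ℚ → ℚ
guard b x = if b then x else 0ℚ

guard-∧ : ∀ a b x y → guard (a ∧ b) (x * y) ≡ guard a x * guard b y
guard-∧ true  true  x y = refl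
guard-∧ true  false x y = sym (*-zeroʳ x)
guard-∧ false b     x y = sym (*-zeroˡ (guard b y))

guard-*ˡ : ∀ b c x → guard b (c * x) ≡ c * guard b x
guard-*ˡ true  c x = refl
guard-*ˡ false c x = sym (*-zeroʳ c)

guard-*-split : ∀ g s w (ψ : Bool → ℚ) →
  guard g w * ψ s ≡ guard (g ∧ s) w * ψ true + guard (g ∧ not s) w * ψ false
guard-*-split true  true  w ψ = solve 2 (λ x y → x := x :+ con 0ℚ :* y) refl (w * ψ true) (ψ false)
guard-*-split true  false w ψ = solve 2 (λ x y → x := con 0ℚ :* y :+ x) refl (w * ψ false) (ψ true)
guard-*-split false s     w ψ =
  solve 3 (λ x y z → con 0ℚ :* x := con 0ℚ :* y :+ con 0ℚ :* z) refl (ψ s) (ψ true) (ψ false)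

sumℚ-++ : ∀ xs ys → sumℚ (xs List.++ ys) ≡ sumℚ xs + sumℚ ys
sumℚ-++ []       ys = sym (+-identityˡ _)
sumℚ-++ (x ∷ xs) ys = trans (cong (x +_) (sumℚ-++ xs ys)) (sym (+-assoc x _ _))

∑ : ∀ m → (Vec Bool m → ℚ) → ℚ
∑ m f = sumℚ (map f (subsets m))

module _ (m : ℕ) where

  ∑-cong : ∀ {f g : Vec Bool m → ℚ} → (∀ A → f A ≡ g A) → ∑ m f ≡ ∑ m g
  ∑-cong f≗g = cong sumℚ (map-cong f≗g (subsets m))

  ∑-*ˡ : ∀ c (f : Vec Bool m → ℚ) → ∑ m (λ A → c * f A) ≡ c * ∑ m f
  ∑-*ˡ c f = go (subsets m)
    where
    go : ∀ As → sumℚ (map (λ A → c * f A) As) ≡ c * sumℚ (map f As)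
    go []       = sym (*-zeroʳ c)
    go (A ∷ As) = trans (cong (c * f A +_) (go As)) (sym (*-distribˡ-+ c (f A) (sumℚ (map f As))))

  ∑-*ʳ : ∀ c (f : Vec Bool m → ℚ) → ∑ m (λ A → f A * c) ≡ ∑ m f * c
  ∑-*ʳ c f = go (subsets m)
    where
    go : ∀ As → sumℚ (map (λ A → f A * c) As) ≡ sumℚ (map f As) * c
    go []       = sym (*-zeroˡ c)
    go (A ∷ As) = trans (cong (f A * c +_) (go As)) (sym (*-distribʳ-+ c (f A) (sumℚ (map f As))))

  ∑-+ : ∀ (f g : Vec Bool m → ℚ) → ∑ m (λ A → f A + g A) ≡ ∑ m f + ∑ m g
  ∑-+ f g = go (subsets m)
    where
    go : ∀ As → sumℚ (map (λ A → f A + g A) As) ≡ sumℚ (map f As) + sumℚ (map g As)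
    go []       = sym (+-identityˡ 0ℚ)
    go (A ∷ As) = trans (cong (f A + g A +_) (go As))
      (solve 4 (λ a b x y → (a :+ b) :+ (x :+ y) := (a :+ x) :+ (b :+ y)) refl (f A) (g A) _ _)

∑-suc : ∀ {m} (f : Vec Bool (suc m) → ℚ) →
  ∑ (suc m) f ≡ ∑ m (λ A → f (true ∷ A)) + ∑ m (λ A → f (false ∷ A))
∑-suc {m} f = begin
  sumℚ (map f (map (true ∷_) (subsets m) List.++ map (false ∷_) (subsets m)))
    ≡⟨ cong sumℚ (map-++ f (map (true ∷_) (subsets m)) (map (false ∷_) (subsets m))) ⟩
  sumℚ (map f (map (true ∷_) (subsets m)) List.++ map f (map (false ∷_) (subsets m)))
    ≡⟨ sumℚ-++ (map f (map (true ∷_) (subsets m))) (map f (map (false ∷_) (subsets m))) ⟩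
  sumℚ (map f (map (true ∷_) (subsets m))) + sumℚ (map f (map (false ∷_) (subsets m)))
    ≡⟨ sym (cong₂ _+_ (cong sumℚ (map-∘ (subsets m))) (cong sumℚ (map-∘ (subsets m)))) ⟩
  ∑ m (λ A → f (true ∷ A)) + ∑ m (λ A → f (false ∷ A)) ∎
  where open ≡-Reasoning

∑-++ : ∀ a {b} (f : Vec Bool (a ℕ.+ b) → ℚ) → ∑ (a ℕ.+ b) f ≡ ∑ a (λ B → ∑ b (λ C → f (B Vec.++ C)))
∑-++ zero    f = sym (+-identityʳ _)
∑-++ (suc a) {b} f = trans (∑-suc f)
  (trans (cong₂ _+_ (∑-++ a (λ A → f (true ∷ A))) (∑-++ a (λ A → f (false ∷ A))))
         (sym (∑-suc (λ B → ∑ b (λ C → f (B Vec.++ C))))))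

weight-++ : ∀ p {a b} (B : Vec Bool a) (C : Vec Bool b) → weight p (B Vec.++ C) ≡ weight p B * weight p C
weight-++ p []          C = sym (*-identityˡ _)
weight-++ p (true ∷ B)  C = trans (cong ((1ℚ - p) *_) (weight-++ p B C)) (sym (*-assoc (1ℚ - p) _ _))
weight-++ p (false ∷ B) C = trans (cong (p *_) (weight-++ p B C)) (sym (*-assoc p _ _))

weightWith : ∀ {n} → ℚ → ℚ → Vec Bool n → ℚ
weightWith a b []          = 1ℚ
weightWith a b (true ∷ Y)  = a * weightWith a b Y
weightWith a b (false ∷ Y) = b * weightWith a b Y

weightWith-scale : ∀ c q {n} (Y : Vec Bool n) → weightWith (c * (1ℚ - q)) (c * q) Y ≡ c ^ n * weight q Y
weightWith-scale c q []          = sym (*-identityˡ 1ℚ)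
weightWith-scale c q (true ∷ Y)  = trans (cong (c * (1ℚ - q) *_) (weightWith-scale c q Y))
  (solve 4 (λ c q k w → (c :* (con 1ℚ :- q)) :* (k :* w) := (c :* k) :* ((con 1ℚ :- q) :* w)) refl c q _ _)
weightWith-scale c q (false ∷ Y) = trans (cong (c * q *_) (weightWith-scale c q Y))
  (solve 4 (λ c q k w → (c :* q) :* (k :* w) := (c :* k) :* (q :* w)) refl c q _ _)

∑-suc-weightWith : ∀ a b {n} (F : Vec Bool (suc n) → Bool) →
  ∑ (suc n) (λ Y → guard (F Y) (weightWith a b Y))
  ≡ a * ∑ n (λ Y → guard (F (true ∷ Y)) (weightWith a b Y))
    + b * ∑ n (λ Y → guard (F (false ∷ Y)) (weightWith a b Y))
∑-suc-weightWith a b {n} F = trans (∑-suc (λ Y → guard (F Y) (weightWith a b Y)))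
  (cong₂ _+_ (trans (∑-cong n (λ Y → guard-*ˡ (F (true ∷ Y)) a _)) (∑-*ˡ n a _))
             (trans (∑-cong n (λ Y → guard-*ˡ (F (false ∷ Y)) b _)) (∑-*ˡ n b _)))

block : ∀ {n mG} → Vec Bool (n ℕ.* mG) → Fin n → Vec Bool mG
block A e = tabulate (λ f → lookup A (combine e f))

module _ {n mG} (B : Vec Bool mG) (C : Vec Bool (n ℕ.* mG)) where

  block-++-zero : block {suc n} (B Vec.++ C) zero ≡ B
  block-++-zero = trans (tabulate-cong (lookup-++ˡ B C)) (tabulate∘lookup B)

  block-++-suc : ∀ e → block {suc n} (B Vec.++ C) (suc e) ≡ block C e
  block-++-suc e = tabulate-cong (λ f → lookup-++ʳ B C (combine e f))

module BlockSum {mG} (good joined : Vec Bool mG → Bool) where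

  allGood : ∀ n → Vec Bool (n ℕ.* mG) → Bool
  allGood n A = all (good ∘ block {n} A) (allFin n)

  joinPattern : ∀ n → Vec Bool (n ℕ.* mG) → Vec Bool n
  joinPattern n A = tabulate (joined ∘ block {n} A)

  module _ {n} (B : Vec Bool mG) (C : Vec Bool (n ℕ.* mG)) where

    allGood-++ : allGood (suc n) (B Vec.++ C) ≡ good B ∧ allGood n C
    allGood-++ = T-ext
      (λ h → let h′ = all-allFin⁻ (good ∘ block {suc n} (B Vec.++ C)) h in
        from (T-∧ {good B}) (subst (T ∘ good) (block-++-zero {n} B C) (h′ zero) ,
                  all-allFin⁺ (good ∘ block {n} C) (λ e → subst (T ∘ good) (block-++-suc {n} B C e) (h′ (suc e)))))
      (λ h → let hB , hC = to (T-∧ {good B}) h in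
        all-allFin⁺ (good ∘ block {suc n} (B Vec.++ C)) λ where
          zero    → subst (T ∘ good) (sym (block-++-zero {n} B C)) hB
          (suc e) → subst (T ∘ good) (sym (block-++-suc {n} B C e)) (all-allFin⁻ (good ∘ block {n} C) hC e))

    joinPattern-++ : joinPattern (suc n) (B Vec.++ C) ≡ joined B ∷ joinPattern n C
    joinPattern-++ = cong₂ _∷_ (cong joined (block-++-zero {n} B C)) (tabulate-cong (cong joined ∘ block-++-suc {n} B C))

  module _ (p : ℚ) where

    rJoined rSplit : ℚ
    rJoined = ∑ mG (λ B → guard (good B ∧ joined B) (weight p B))
    rSplit  = ∑ mG (λ B → guard (good B ∧ not (joined B)) (weight p B))

    ∑-by-joined : ∀ (ψ : Bool → ℚ) →
      ∑ mG (λ B → guard (good B) (weight p B) * ψ (joined B)) ≡ rJoined * ψ true + rSplit * ψ false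
    ∑-by-joined ψ = begin
      ∑ mG (λ B → guard (good B) (weight p B) * ψ (joined B))
        ≡⟨ ∑-cong mG (λ B → guard-*-split (good B) (joined B) (weight p B) ψ) ⟩
      ∑ mG (λ B → guard (good B ∧ joined B) (weight p B) * ψ true
                 + guard (good B ∧ not (joined B)) (weight p B) * ψ false)
        ≡⟨ ∑-+ mG _ _ ⟩
      ∑ mG (λ B → guard (good B ∧ joined B) (weight p B) * ψ true)
        + ∑ mG (λ B → guard (good B ∧ not (joined B)) (weight p B) * ψ false)
        ≡⟨ cong₂ _+_ (∑-*ʳ mG (ψ true) _) (∑-*ʳ mG (ψ false) _) ⟩
      rJoined * ψ true + rSplit * ψ false ∎
      where open ≡-Reasoning

    ∑-blocks : ∀ n (F : Vec Bool n → Bool) →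
      ∑ (n ℕ.* mG) (λ A → guard (allGood n A ∧ F (joinPattern n A)) (weight p A))
      ≡ ∑ n (λ Y → guard (F Y) (weightWith rJoined rSplit Y))
    ∑-blocks zero    F = refl
    ∑-blocks (suc n) F = begin
      ∑ (mG ℕ.+ n ℕ.* mG) summand
        ≡⟨ ∑-++ mG summand ⟩
      ∑ mG (λ B → ∑ (n ℕ.* mG) (λ C → summand (B Vec.++ C)))
        ≡⟨ ∑-cong mG (λ B → trans (∑-cong (n ℕ.* mG) (summand-++ B))
                          (trans (∑-*ˡ (n ℕ.* mG) (guard (good B) (weight p B)) _)
                                 (cong (guard (good B) (weight p B) *_) (∑-blocks n (λ Y → F (joined B ∷ Y)))))) ⟩
      ∑ mG (λ B → guard (good B) (weight p B) * ψ (joined B))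
        ≡⟨ ∑-by-joined ψ ⟩
      rJoined * ψ true + rSplit * ψ false
        ≡⟨ sym (∑-suc-weightWith rJoined rSplit F) ⟩
      ∑ (suc n) (λ Y → guard (F Y) (weightWith rJoined rSplit Y)) ∎
      where
      open ≡-Reasoning
      summand : Vec Bool (mG ℕ.+ n ℕ.* mG) → ℚ
      summand A = guard (allGood (suc n) A ∧ F (joinPattern (suc n) A)) (weight p A)
      ψ : Bool → ℚ
      ψ b = ∑ n (λ Y → guard (F (b ∷ Y)) (weightWith rJoined rSplit Y))
      summand-++ : ∀ B C → summand (B Vec.++ C)
                 ≡ guard (good B) (weight p B) * guard (allGood n C ∧ F (joined B ∷ joinPattern n C)) (weight p C)
      summand-++ B C = begin
        guard (allGood (suc n) (B Vec.++ C) ∧ F (joinPattern (suc n) (B Vec.++ C))) (weight p (B Vec.++ C))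
          ≡⟨ cong₂ guard (cong₂ _∧_ (allGood-++ {n} B C) (cong F (joinPattern-++ {n} B C))) (weight-++ p B C) ⟩
        guard ((good B ∧ allGood n C) ∧ F (joined B ∷ joinPattern n C)) (weight p B * weight p C)
          ≡⟨ cong (λ b → guard b (weight p B * weight p C)) (∧-assoc (good B) _ _) ⟩
        guard (good B ∧ (allGood n C ∧ F (joined B ∷ joinPattern n C))) (weight p B * weight p C)
          ≡⟨ guard-∧ (good B) _ (weight p B) (weight p C) ⟩
        guard (good B) (weight p B) * guard (allGood n C ∧ F (joined B ∷ joinPattern n C)) (weight p C) ∎

module _ {n m} (G : TwoTerminal n m) (B : Vec Bool m) where

  anchoredᵇ : Bool
  anchoredᵇ = all (λ x → path (graph G) B x (src G) ∨ path (graph G) B x (snk G)) (allFin n)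

  joinedᵇ : Bool
  joinedᵇ = path (graph G) B (src G) (snk G)

module Terminals {n m} (G : TwoTerminal n m) (B : Vec Bool m) where

  open Reachability (graph G) B

  Anchored : Set
  Anchored = ∀ x → Reach x (src G) ⊎ Reach x (snk G)

  anchored⁻ : T (anchoredᵇ G B) → Anchored
  anchored⁻ h x with to (T-∨ {path (graph G) B x (src G)}) (all-allFin⁻ _ h x)
  ... | inj₁ xs = inj₁ (path⇒Reach xs)
  ... | inj₂ xt = inj₂ (path⇒Reach xt)

  anchored⁺ : Anchored → T (anchoredᵇ G B)
  anchored⁺ h = all-allFin⁺ _ λ x → from T-∨ (Sum.map Reach⇒path Reach⇒path (h x))

  connectedᵇ-anchored-joined : connectedᵇ (graph G) B ≡ anchoredᵇ G B ∧ joinedᵇ G B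
  connectedᵇ-anchored-joined = T-ext connected⇒ ⇒connected
    where
    s t : Fin n
    s = src G
    t = snk G
    connected⇒ : T (connectedᵇ (graph G) B) → T (anchoredᵇ G B ∧ joinedᵇ G B)
    connected⇒ h = from T-∧ (anchored⁺ (λ x → inj₁ (reach x s)) , Reach⇒path (reach s t))
      where
      reach : ∀ x y → Reach x y
      reach x y = path⇒Reach (all-allFin⁻ _ (all-allFin⁻ _ h x) y)
    ⇒connected : T (anchoredᵇ G B ∧ joinedᵇ G B) → T (connectedᵇ (graph G) B)
    ⇒connected h with to (T-∧ {anchoredᵇ G B}) h
    ... | anchored , joined =
      all-allFin⁺ _ λ x → all-allFin⁺ _ λ y → Reach⇒path (toSrc x ◅◅ Reach-sym (toSrc y))
      where
      toSrc : ∀ x → Reach x s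
      toSrc x = Sum.[ id , _◅◅ Reach-sym (path⇒Reach joined) ] (anchored⁻ anchored x)

  splitᵇ-anchored-disjoined : splitᵇ (graph G) (src G) (snk G) B ≡ anchoredᵇ G B ∧ not (joinedᵇ G B)
  splitᵇ-anchored-disjoined = T-ext split⇒ ⇒split
    where
    s t : Fin n
    s = src G
    t = snk G
    _⇝_ : Fin n → Fin n → Bool
    x ⇝ y = path (graph G) B x y
    split⇒ : T (splitᵇ (graph G) s t B) → T (anchoredᵇ G B ∧ not (joinedᵇ G B))
    split⇒ h = from T-∧ ( all-allFin⁺ _ (λ x → T-xor⁻ {x ⇝ s} (exactlyOne x))
                        , T-xor-not (Reach⇒path ε) (exactlyOne s))
      where
      exactlyOne : ∀ x → T (x ⇝ s xor x ⇝ t)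
      exactlyOne = all-allFin⁻ (λ x → x ⇝ s xor x ⇝ t) h
    ⇒split : T (anchoredᵇ G B ∧ not (joinedᵇ G B)) → T (splitᵇ (graph G) s t B)
    ⇒split h with to (T-∧ {anchoredᵇ G B}) h
    ... | anchored , disjoined = all-allFin⁺ (λ x → x ⇝ s xor x ⇝ t) λ x →
      T-xor⁺ (all-allFin⁻ (λ x → x ⇝ s ∨ x ⇝ t) anchored x)
             (λ (xs , xt) → T-not⁻ disjoined (Reach⇒path (Reach-sym (path⇒Reach xs) ◅◅ path⇒Reach xt)))

÷-scaled : ∀ {a b a′ b′} K → a ≡ K * a′ → b ≡ K * b′ →
           .{{_ : NonZero b}} .{{_ : NonZero b′}} → a ÷ b ≡ a′ ÷ b′
÷-scaled {a} {b} {a′} {b′} K refl refl = begin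
  K * a′ * 1/ b                                ≡⟨ sym (*-identityʳ _) ⟩
  K * a′ * 1/ b * 1ℚ                           ≡⟨ cong (K * a′ * 1/ b *_) (sym (*-inverseʳ b′)) ⟩
  K * a′ * 1/ b * (b′ * 1/ b′)
    ≡⟨ solve 5 (λ K a′ i b′ i′ → K :* a′ :* i :* (b′ :* i′) := a′ :* i′ :* (K :* b′ :* i)) refl K a′ (1/ b) b′ (1/ b′) ⟩
  a′ * 1/ b′ * (b * 1/ b)                      ≡⟨ cong (a′ * 1/ b′ *_) (*-inverseʳ b) ⟩
  a′ * 1/ b′ * 1ℚ                              ≡⟨ *-identityʳ _ ⟩
  a′ * 1/ b′                                   ∎
  where open ≡-Reasoning

module VirtualEdge (r σ : ℚ) .{{_ : NonZero σ}} .{{_ : NonZero (r ÷ σ + 1ℚ)}} where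

  y : ℚ
  y = r ÷ σ + 1ℚ

  y*σ : y * σ ≡ r + σ
  y*σ = begin
    (r * 1/ σ + 1ℚ) * σ
      ≡⟨ solve 3 (λ r i σ → (r :* i :+ con 1ℚ) :* σ := r :* (i :* σ) :+ σ) refl r (1/ σ) σ ⟩
    r * (1/ σ * σ) + σ    ≡⟨ cong (λ z → r * z + σ) (*-inverseˡ σ) ⟩
    r * 1ℚ + σ            ≡⟨ cong (_+ σ) (*-identityʳ r) ⟩
    r + σ                 ∎
    where open ≡-Reasoning

  σ≡[r+σ]*1/y : σ ≡ (r + σ) * 1/ y
  σ≡[r+σ]*1/y = begin
    σ                     ≡⟨ sym (*-identityʳ σ) ⟩
    σ * 1ℚ                ≡⟨ cong (σ *_) (sym (*-inverseʳ y)) ⟩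
    σ * (y * 1/ y)        ≡⟨ solve 3 (λ σ y i → σ :* (y :* i) := y :* σ :* i) refl σ y (1/ y) ⟩
    y * σ * 1/ y          ≡⟨ cong (_* 1/ y) y*σ ⟩
    (r + σ) * 1/ y        ∎
    where open ≡-Reasoning

  r≡[r+σ]*[1-1/y] : r ≡ (r + σ) * (1ℚ - 1/ y)
  r≡[r+σ]*[1-1/y] = begin
    r                            ≡⟨ solve 2 (λ r σ → r := r :+ σ :- σ) refl r σ ⟩
    r + σ - σ                    ≡⟨ cong (r + σ -_) σ≡[r+σ]*1/y ⟩
    r + σ - (r + σ) * 1/ y       ≡⟨ solve 2 (λ c q → c :- c :* q := c :* (con 1ℚ :- q)) refl (r + σ) (1/ y) ⟩
    (r + σ) * (1ℚ - 1/ y)        ∎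
    where open ≡-Reasoning

module InternalVertices {k} {s t : Fin (suc (suc k))} (s≢t : s ≢ t) where

  fromInternal : Fin k → Fin (suc (suc k))
  fromInternal y = punchIn s (punchIn (punchOut s≢t) y)

  fromInternal≢s : ∀ y → fromInternal y ≢ s
  fromInternal≢s y = punchInᵢ≢i s _

  fromInternal≢t : ∀ y → fromInternal y ≢ t
  fromInternal≢t y eq = punchInᵢ≢i (punchOut s≢t) y (punchIn-injective s _ _ (trans eq (sym (punchIn-punchOut s≢t))))

  fromInternal-internal : ∀ x x≢s x≢t → fromInternal (internal s t x s≢t x≢s x≢t) ≡ x
  fromInternal-internal x x≢s x≢t = trans (cong (punchIn s) (punchIn-punchOut _)) (punchIn-punchOut _)

  internal-fromInternal : ∀ y y≢s y≢t → internal s t (fromInternal y) s≢t y≢s y≢t ≡ y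
  internal-fromInternal y y≢s y≢t =
    trans (punchOut-cong (punchOut s≢t) (trans (punchOut-cong s refl) (punchOut-punchIn s))) (punchOut-punchIn (punchOut s≢t))

  data TerminalView : Fin (suc (suc k)) → Set where
    source : TerminalView s
    sink   : TerminalView t
    inner  : ∀ y → TerminalView (fromInternal y)

  terminalView : ∀ x → TerminalView x
  terminalView x with x Fin.≟ s | x Fin.≟ t
  ... | yes refl | _        = source
  ... | no _     | yes refl = sink
  ... | no x≢s   | no x≢t   = subst TerminalView (fromInternal-internal x x≢s x≢t) (inner _)

module Substitution {nH mH k mG} (H : TwoTerminal nH mH) (G : TwoTerminal (suc (suc k)) mG) (o : Fin mH → Bool) where

  open InternalVertices (src≢snk G)

  HG : TwoTerminal (nH ℕ.+ mH ℕ.* k) (mH ℕ.* mG)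
  HG = substitute H G o

  s t : Fin (suc (suc k))
  s = src G
  t = snk G

  base : Fin nH → Fin (nH ℕ.+ mH ℕ.* k)
  base u = u ↑ˡ (mH ℕ.* k)

  copy : Fin mH → Fin k → Fin (nH ℕ.+ mH ℕ.* k)
  copy e y = nH ↑ʳ combine e y

  glueSrc glueSnk : Fin mH → Fin nH
  glueSrc e = if o e then proj₁ (edge (graph H) e) else proj₂ (edge (graph H) e)
  glueSnk e = if o e then proj₂ (edge (graph H) e) else proj₁ (edge (graph H) e)

  -- The same case split as in `substitute`, so that `edge-substitute` holds by computation.
  place : Fin mH → Fin (suc (suc k)) → Fin (nH ℕ.+ mH ℕ.* k)
  place e x = placeBy (x Fin.≟ s) (x Fin.≟ t)
    where
    placeBy : Dec (x ≡ s) → Dec (x ≡ t) → Fin (nH ℕ.+ mH ℕ.* k)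
    placeBy (yes _)   _         = base (glueSrc e)
    placeBy (no _)    (yes _)   = base (glueSnk e)
    placeBy (no x≢s)  (no x≢t)  = copy e (internal s t x (src≢snk G) x≢s x≢t)

  edge-substitute : ∀ i → let (e , f) = remQuot {mH} mG i in
    edge (graph HG) i ≡ (place e (proj₁ (edge (graph G) f)) , place e (proj₂ (edge (graph G) f)))
  edge-substitute i with proj₁ (edge (graph G) (proj₂ (remQuot {mH} mG i))) Fin.≟ s
                       | proj₁ (edge (graph G) (proj₂ (remQuot {mH} mG i))) Fin.≟ t
                       | proj₂ (edge (graph G) (proj₂ (remQuot {mH} mG i))) Fin.≟ s
                       | proj₂ (edge (graph G) (proj₂ (remQuot {mH} mG i))) Fin.≟ t
  ... | yes _ | _     | yes _ | _     = refl
  ... | yes _ | _     | no _  | yes _ = refl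
  ... | yes _ | _     | no _  | no _  = refl
  ... | no _  | yes _ | yes _ | _     = refl
  ... | no _  | yes _ | no _  | yes _ = refl
  ... | no _  | yes _ | no _  | no _  = refl
  ... | no _  | no _  | yes _ | _     = refl
  ... | no _  | no _  | no _  | yes _ = refl
  ... | no _  | no _  | no _  | no _  = refl

  edge-substitute-combine : ∀ e f → edge (graph HG) (combine e f) ≡ Product.map (place e) (place e) (edge (graph G) f)
  edge-substitute-combine e f =
    trans (edge-substitute (combine e f))
          (cong (λ (e′ , f′) → Product.map (place e′) (place e′) (edge (graph G) f′)) (remQuot-combine e f))

  place-src : ∀ e → place e s ≡ base (glueSrc e)
  place-src e with s Fin.≟ s
  ... | yes _   = refl
  ... | no s≢s = ⊥-elim (s≢s refl)

  place-snk : ∀ e → place e t ≡ base (glueSnk e)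
  place-snk e with t Fin.≟ s | t Fin.≟ t
  ... | yes t≡s | _       = ⊥-elim (src≢snk G (sym t≡s))
  ... | no _    | yes _   = refl
  ... | no _    | no t≢t = ⊥-elim (t≢t refl)

  place-fromInternal : ∀ e y → place e (fromInternal y) ≡ copy e y
  place-fromInternal e y with fromInternal y Fin.≟ s | fromInternal y Fin.≟ t
  ... | yes y≡s | _       = ⊥-elim (fromInternal≢s y y≡s)
  ... | no _    | yes y≡t = ⊥-elim (fromInternal≢t y y≡t)
  ... | no y≢s  | no y≢t  = cong (copy e) (internal-fromInternal y y≢s y≢t)

  base≢copy : ∀ u e y → base u ≢ copy e y
  base≢copy u e y eq
    with trans (sym (splitAt-↑ˡ nH u (mH ℕ.* k))) (trans (cong (Fin.splitAt nH) eq) (splitAt-↑ʳ nH _ (combine e y)))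
  ... | ()

  place≡copy : ∀ e x e′ y → place e x ≡ copy e′ y → e ≡ e′ × x ≡ fromInternal y
  place≡copy e x e′ y eq with terminalView x
  ... | source    = ⊥-elim (base≢copy _ e′ y (trans (sym (place-src e)) eq))
  ... | sink      = ⊥-elim (base≢copy _ e′ y (trans (sym (place-snk e)) eq))
  ... | inner y′ with ↑ʳ-injective nH _ _ (trans (sym (place-fromInternal e y′)) eq)
  ...   | same = combine-injectiveˡ e y′ e′ y same , cong fromInternal (combine-injectiveʳ e y′ e′ y same)

  data Vertex : Fin (nH ℕ.+ mH ℕ.* k) → Set where
    base-vertex : ∀ u → Vertex (base u)
    copy-vertex : ∀ e y → Vertex (copy e y)

  vertexView : ∀ w → Vertex w
  vertexView w = subst Vertex (join-splitAt nH (mH ℕ.* k) w) (bySplit (Fin.splitAt nH w))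
    where
    bySplit : ∀ x → Vertex (Fin.join nH (mH ℕ.* k) x)
    bySplit (inj₁ u) = base-vertex u
    bySplit (inj₂ j) = subst (Vertex ∘ (nH ↑ʳ_)) (combine-remQuot {mH} k j) (copy-vertex _ _)

  open BlockSum (anchoredᵇ G) (joinedᵇ G) using (allGood; joinPattern)

  module _ (A : Vec Bool (mH ℕ.* mG)) where

    X : Vec Bool mH
    X = joinPattern mH A

    module InCopy (e : Fin mH) = Reachability (graph G) (block A e)
    module InH = Reachability (graph H) X
    module InHG = Reachability (graph HG) A

    lookup-block : ∀ (e : Fin mH) (f : Fin mG) → lookup (block A e) f ≡ lookup A (combine e f)
    lookup-block e f = lookup∘tabulate (λ f → lookup A (combine e f)) f

    lift-copy : ∀ e {x y} → InCopy.Reach e x y → InHG.Reach (place e x) (place e y)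
    lift-copy e = gmap (place e) lift-adjacent
      where
      lift-adjacent : ∀ {x y} → InCopy.Adjacent e x y → InHG.Adjacent (place e x) (place e y)
      lift-adjacent (f , a , ends) =
        combine e f , subst T (lookup-block e f) a ,
        Sum.map (λ xy → trans (edge-substitute-combine e f) (cong (Product.map (place e) (place e)) xy))
                (λ yx → trans (edge-substitute-combine e f) (cong (Product.map (place e) (place e)) yx)) ends

    selected-in-block : ∀ i → T (lookup A i) → let (e , f) = remQuot {mH} mG i in T (lookup (block A e) f)
    selected-in-block i a =
      subst T (sym (lookup-block e f)) (subst (T ∘ lookup A) (sym (combine-remQuot {mH} mG i)) a)
      where
      e : Fin mH
      e = proj₁ (remQuot {mH} mG i)
      f : Fin mG
      f = proj₂ (remQuot {mH} mG i)

    adjacent-in-copy : ∀ {w z} → InHG.Adjacent w z →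
      ∃ λ e → ∃₂ λ x y → InCopy.Adjacent e x y × w ≡ place e x × z ≡ place e y
    adjacent-in-copy (i , a , inj₁ wz) =
      _ , _ , _ , (_ , selected-in-block i a , inj₁ refl) ,
      cong proj₁ (trans (sym wz) (edge-substitute i)) , cong proj₂ (trans (sym wz) (edge-substitute i))
    adjacent-in-copy (i , a , inj₂ zw) =
      _ , _ , _ , (_ , selected-in-block i a , inj₂ refl) ,
      cong proj₂ (trans (sym zw) (edge-substitute i)) , cong proj₁ (trans (sym zw) (edge-substitute i))

    lookup-X : ∀ e → lookup X e ≡ joinedᵇ G (block A e)
    lookup-X e = lookup∘tabulate (joinedᵇ G ∘ block A) e

    side : Fin mH → Fin (suc (suc k)) → Fin nH
    side e x = if path (graph G) (block A e) x s then glueSrc e else glueSnk e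

    -- Collapses every copy onto the two ends of its edge; A-walks in H(G) become X-walks in H.
    project : Fin (nH ℕ.+ mH ℕ.* k) → Fin nH
    project w =
      Sum.[ id , (λ j → side (proj₁ (remQuot {mH} k j)) (fromInternal (proj₂ (remQuot {mH} k j)))) ]′ (Fin.splitAt nH w)

    project-base : ∀ u → project (base u) ≡ u
    project-base u rewrite splitAt-↑ˡ nH u (mH ℕ.* k) = refl

    project-copy : ∀ e y → project (copy e y) ≡ side e (fromInternal y)
    project-copy e y rewrite splitAt-↑ʳ nH (mH ℕ.* k) (combine e y) =
      cong (λ (e′ , y′) → side e′ (fromInternal y′)) (remQuot-combine {mH} {k} e y)

    project-place-glued : ∀ e x → project (place e x) ≡ glueSrc e ⊎ project (place e x) ≡ glueSnk e
    project-place-glued e x with terminalView x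
    ... | source   = inj₁ (trans (cong project (place-src e)) (project-base _))
    ... | sink     = inj₂ (trans (cong project (place-snk e)) (project-base _))
    ... | inner y  rewrite place-fromInternal e y | project-copy e y
                   with path (graph G) (block A e) (fromInternal y) s
    ...   | true  = inj₁ refl
    ...   | false = inj₂ refl

    project-place-unjoined : ∀ e x → ¬ T (lookup X e) → project (place e x) ≡ side e x
    project-place-unjoined e x unjoined with terminalView x
    ... | source  rewrite place-src e | project-base (glueSrc e)
                        | to T-≡ (InCopy.Reach⇒path e {s} ε) = refl
    ... | sink    rewrite place-snk e | project-base (glueSnk e)
                  with path (graph G) (block A e) t s in ts
    ...   | true  = ⊥-elim (unjoined (subst T (sym (lookup-X e))
                      (InCopy.Reach⇒path e (InCopy.Reach-sym e (InCopy.path⇒Reach e (from T-≡ ts))))))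
    ...   | false = refl
    project-place-unjoined e x unjoined | inner y = trans (cong project (place-fromInternal e y)) (project-copy e y)

    glued-adjacent : ∀ e → T (lookup X e) → InH.Adjacent (glueSrc e) (glueSnk e)
    glued-adjacent e joined with o e
    ... | true  = e , joined , inj₁ refl
    ... | false = e , joined , inj₂ refl

    glued-reach : ∀ e {a b} → T (lookup X e) →
      (a ≡ glueSrc e ⊎ a ≡ glueSnk e) → (b ≡ glueSrc e ⊎ b ≡ glueSnk e) → InH.Reach a b
    glued-reach e joined (inj₁ refl) (inj₁ refl) = ε
    glued-reach e joined (inj₁ refl) (inj₂ refl) = glued-adjacent e joined ◅ ε
    glued-reach e joined (inj₂ refl) (inj₁ refl) = InH.Adjacent-sym (glued-adjacent e joined) ◅ ε
    glued-reach e joined (inj₂ refl) (inj₂ refl) = ε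

    side-adjacent : ∀ e {x y} → InCopy.Adjacent e x y → side e x ≡ side e y
    side-adjacent e adj = cong (λ b → if b then glueSrc e else glueSnk e)
      (T-ext (λ xs → InCopy.Reach⇒path e (InCopy.Reach-sym e (adj ◅ ε) ◅◅ InCopy.path⇒Reach e xs))
             (λ ys → InCopy.Reach⇒path e (adj ◅ InCopy.path⇒Reach e ys)))

    Reach-project : ∀ {w z} → InHG.Reach w z → InH.Reach (project w) (project z)
    Reach-project = kleisliStar project project-adjacent
      where
      project-adjacent : ∀ {w z} → InHG.Adjacent w z → InH.Reach (project w) (project z)
      project-adjacent adj with adjacent-in-copy adj
      ... | e , x , y , adj′ , refl , refl with T? (lookup X e)
      ...   | yes joined  = glued-reach e joined (project-place-glued e x) (project-place-glued e y)
      ...   | no unjoined = subst₂ InH.Reach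
          (sym (project-place-unjoined e x unjoined)) (sym (project-place-unjoined e y unjoined))
          (subst (InH.Reach (side e x)) (side-adjacent e adj′) ε)

    glued-lift : ∀ e → T (lookup X e) → InHG.Reach (base (glueSrc e)) (base (glueSnk e))
    glued-lift e joined = subst₂ InHG.Reach (place-src e) (place-snk e)
      (lift-copy e (InCopy.path⇒Reach e (subst T (lookup-X e) joined)))

    Reach-lift : ∀ {u v} → InH.Reach u v → InHG.Reach (base u) (base v)
    Reach-lift = kleisliStar base lift-adjacent
      where
      lift-adjacent : ∀ {u v} → InH.Adjacent u v → InHG.Reach (base u) (base v)
      lift-adjacent (e , joined , ends) with o e | glued-lift e joined
      lift-adjacent (e , _ , inj₁ refl) | true  | r = r
      lift-adjacent (e , _ , inj₂ refl) | true  | r = InHG.Reach-sym r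
      lift-adjacent (e , _ , inj₁ refl) | false | r = InHG.Reach-sym r
      lift-adjacent (e , _ , inj₂ refl) | false | r = r

    toward-side : ∀ e x → InCopy.Reach e x s ⊎ InCopy.Reach e x t → InHG.Reach (place e x) (base (side e x))
    toward-side e x anchored with path (graph G) (block A e) x s in xs | anchored
    ... | true  | _      =
      subst (InHG.Reach (place e x)) (place-src e) (lift-copy e (InCopy.path⇒Reach e (from T-≡ xs)))
    ... | false | inj₁ r = ⊥-elim (subst T xs (InCopy.Reach⇒path e r))
    ... | false | inj₂ r = subst (InHG.Reach (place e x)) (place-snk e) (lift-copy e r)

    Reach-to-base : T (allGood mH A) → ∀ w → InHG.Reach w (base (project w))
    Reach-to-base good w with vertexView w
    ... | base-vertex u rewrite project-base u = ε
    ... | copy-vertex e y rewrite project-copy e y =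
      subst (λ w → InHG.Reach w (base (side e (fromInternal y)))) (place-fromInternal e y)
        (toward-side e (fromInternal y)
          (Terminals.anchored⁻ G (block A e) (all-allFin⁻ _ good e) (fromInternal y)))

    module _ (e : Fin mH) (x : Fin (suc (suc k))) (¬xs : ¬ InCopy.Reach e x s) (¬xt : ¬ InCopy.Reach e x t) where

      -- A walk leaving an internal vertex can only exit its copy through s or t.
      confined : ∀ {x′ z} → InCopy.Reach e x x′ → InHG.Reach (place e x′) z →
                 ∃ λ y → InCopy.Reach e x y × z ≡ place e y
      confined r ε = _ , r , refl
      confined {x′} r (adj ◅ rest) with adjacent-in-copy adj
      ... | e₂ , x₂ , y₂ , adj′ , here , refl with terminalView x′
      ...   | source   = ⊥-elim (¬xs r)
      ...   | sink     = ⊥-elim (¬xt r)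
      ...   | inner y′ with place≡copy e₂ x₂ e y′ (trans (sym here) (place-fromInternal e y′))
      ...     | refl , refl = confined (r ◅◅ adj′ ◅ ε) rest

      stranded : ∀ u → ¬ InHG.Reach (place e x) (base u)
      stranded u r with confined ε r
      ... | y , r′ , eq with terminalView y
      ...   | source   = ¬xs r′
      ...   | sink     = ¬xt r′
      ...   | inner y′ = base≢copy u e y′ (trans eq (place-fromInternal e y′))

    allGood-unless-stranded : (∀ e x → ¬ InCopy.Reach e x s → ¬ InCopy.Reach e x t → ⊥) → T (allGood mH A)
    allGood-unless-stranded h = all-allFin⁺ _ λ e → all-allFin⁺ _ λ x →
      T-∨-stable (λ ¬xs ¬xt → h e x (¬xs ∘ InCopy.Reach⇒path e) (¬xt ∘ InCopy.Reach⇒path e))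

    path-substitute : T (allGood mH A) → ∀ w v → path (graph HG) A w (base v) ≡ path (graph H) X (project w) v
    path-substitute good w v = T-ext
      (λ h → InH.Reach⇒path
               (subst (InH.Reach (project w)) (project-base v) (Reach-project (InHG.path⇒Reach h))))
      (λ h → InHG.Reach⇒path (Reach-to-base good w ◅◅ Reach-lift (InH.path⇒Reach h)))

    path-substitute-base : T (allGood mH A) → ∀ u v → path (graph HG) A (base u) (base v) ≡ path (graph H) X u v
    path-substitute-base good u v =
      trans (path-substitute good (base u) v) (cong (λ u′ → path (graph H) X u′ v) (project-base u))

    connectedᵇ-substitute : connectedᵇ (graph HG) A ≡ allGood mH A ∧ connectedᵇ (graph H) X
    connectedᵇ-substitute = T-ext connected⇒ ⇒connected
      where
      connected⇒ : T (connectedᵇ (graph HG) A) → T (allGood mH A ∧ connectedᵇ (graph H) X)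
      connected⇒ h = from T-∧ (good , all-allFin⁺ _ λ u → all-allFin⁺ _ λ v →
                                        subst T (path-substitute-base good u v) (conn (base u) (base v)))
        where
        conn : ∀ w z → T (path (graph HG) A w z)
        conn w z = all-allFin⁻ _ (all-allFin⁻ _ h w) z
        good : T (allGood mH A)
        good = allGood-unless-stranded λ e x ¬xs ¬xt →
          stranded e x ¬xs ¬xt (src H) (InHG.path⇒Reach (conn _ _))
      ⇒connected : T (allGood mH A ∧ connectedᵇ (graph H) X) → T (connectedᵇ (graph HG) A)
      ⇒connected h with to (T-∧ {allGood mH A}) h
      ... | good , connH = all-allFin⁺ _ λ w → all-allFin⁺ _ λ z → InHG.Reach⇒path
        (Reach-to-base good w
          ◅◅ Reach-lift (InH.path⇒Reach (all-allFin⁻ _ (all-allFin⁻ _ connH (project w)) (project z)))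
          ◅◅ InHG.Reach-sym (Reach-to-base good z))

    splitᵇ-substitute : splitᵇ (graph HG) (src HG) (snk HG) A ≡ allGood mH A ∧ splitᵇ (graph H) (src H) (snk H) X
    splitᵇ-substitute = T-ext split⇒ ⇒split
      where
      split⇒ : T (splitᵇ (graph HG) (src HG) (snk HG) A) →
               T (allGood mH A ∧ splitᵇ (graph H) (src H) (snk H) X)
      split⇒ h = from T-∧ (good , all-allFin⁺ _ λ u →
        subst T (cong₂ _xor_ (path-substitute-base good u (src H)) (path-substitute-base good u (snk H)))
                (exactlyOne (base u)))
        where
        exactlyOne : ∀ w → T (path (graph HG) A w (src HG) xor path (graph HG) A w (snk HG))
        exactlyOne = all-allFin⁻ _ h
        good : T (allGood mH A)
        good = allGood-unless-stranded λ e x ¬xs ¬xt →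
          Sum.[ stranded e x ¬xs ¬xt (src H) ∘ InHG.path⇒Reach
              , stranded e x ¬xs ¬xt (snk H) ∘ InHG.path⇒Reach ]′
            (to T-∨ (T-xor⁻ {path (graph HG) A (place e x) (src HG)} (exactlyOne (place e x))))
      ⇒split : T (allGood mH A ∧ splitᵇ (graph H) (src H) (snk H) X) →
               T (splitᵇ (graph HG) (src HG) (snk HG) A)
      ⇒split h with to (T-∧ {allGood mH A}) h
      ... | good , splitH = all-allFin⁺ _ λ w →
        subst T (sym (cong₂ _xor_ (path-substitute good w (src H)) (path-substitute good w (snk H))))
                (all-allFin⁻ _ splitH (project w))

  module _ (p : ℚ) .{{_ : NonZero (S G p)}} .{{_ : NonZero (ŷ G p)}} where

    open BlockSum (anchoredᵇ G) (joinedᵇ G) using (rJoined; rSplit; ∑-blocks)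
    open VirtualEdge (R (graph G) p) (S G p) using (r≡[r+σ]*[1-1/y]; σ≡[r+σ]*1/y)

    rJoined≡R : rJoined p ≡ R (graph G) p
    rJoined≡R =
      ∑-cong mG (λ B → cong (λ b → guard b (weight p B)) (sym (Terminals.connectedᵇ-anchored-joined G B)))

    rSplit≡S : rSplit p ≡ S G p
    rSplit≡S =
      ∑-cong mG (λ B → cong (λ b → guard b (weight p B)) (sym (Terminals.splitᵇ-anchored-disjoined G B)))

    ∑-substitute : ∀ (P : Vec Bool (mH ℕ.* mG) → Bool) (F : Vec Bool mH → Bool) →
      (∀ A → P A ≡ allGood mH A ∧ F (joinPattern mH A)) →
      ∑ (mH ℕ.* mG) (λ A → guard (P A) (weight p A))
      ≡ (R (graph G) p + S G p) ^ mH * ∑ mH (λ Y → guard (F Y) (weight (1/ ŷ G p) Y))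
    ∑-substitute P F P≡ = begin
      ∑ (mH ℕ.* mG) (λ A → guard (P A) (weight p A))
        ≡⟨ ∑-cong (mH ℕ.* mG) (λ A → cong (λ b → guard b (weight p A)) (P≡ A)) ⟩
      ∑ (mH ℕ.* mG) (λ A → guard (allGood mH A ∧ F (joinPattern mH A)) (weight p A))
        ≡⟨ ∑-blocks p mH F ⟩
      ∑ mH (λ Y → guard (F Y) (weightWith (rJoined p) (rSplit p) Y))
        ≡⟨ ∑-cong mH (λ Y → cong (guard (F Y)) (begin
             weightWith (rJoined p) (rSplit p) Y
               ≡⟨ cong₂ (λ a b → weightWith a b Y)
                        (trans rJoined≡R r≡[r+σ]*[1-1/y]) (trans rSplit≡S σ≡[r+σ]*1/y) ⟩
             weightWith (c * (1ℚ - 1/ ŷ G p)) (c * 1/ ŷ G p) Y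
               ≡⟨ weightWith-scale c (1/ ŷ G p) Y ⟩
             c ^ mH * weight (1/ ŷ G p) Y ∎)) ⟩
      ∑ mH (λ Y → guard (F Y) (c ^ mH * weight (1/ ŷ G p) Y))
        ≡⟨ ∑-cong mH (λ Y → guard-*ˡ (F Y) (c ^ mH) _) ⟩
      ∑ mH (λ Y → c ^ mH * guard (F Y) (weight (1/ ŷ G p) Y))
        ≡⟨ ∑-*ˡ mH (c ^ mH) _ ⟩
      c ^ mH * ∑ mH (λ Y → guard (F Y) (weight (1/ ŷ G p) Y)) ∎
      where
      open ≡-Reasoning
      c : ℚ
      c = R (graph G) p + S G p

    R-substitute : R (graph HG) p ≡ (R (graph G) p + S G p) ^ mH * R (graph H) (1/ ŷ G p)
    R-substitute = ∑-substitute _ (connectedᵇ (graph H)) connectedᵇ-substitute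

    S-substitute : S HG p ≡ (R (graph G) p + S G p) ^ mH * S H (1/ ŷ G p)
    S-substitute = ∑-substitute _ (splitᵇ (graph H) (src H) (snk H)) splitᵇ-substitute

lemma2p7 : ∀ {nH mH k mG} (H : TwoTerminal nH mH) (G : TwoTerminal (suc (suc k)) mG) →
    Connected (graph G) → (o : Fin mH → Bool) → (p : ℚ) →
    .{{nzG : NonZero (S G p)}} → .{{nzŷ : NonZero (ŷ G p)}} →
    .{{nzH : NonZero (S H (1/ ŷ G p))}} → .{{nzHG : NonZero (S (substitute H G o) p)}} →
    ŷ (substitute H G o) p ≡ ŷ H (1/ ŷ G p)
lemma2p7 {mH = mH} H G _ o p =
  cong (_+ 1ℚ) (÷-scaled ((R (graph G) p + S G p) ^ mH) (R-substitute p) (S-substitute p))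
  where open Substitution H G o
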